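{- The inner deterministic multirelations form a category whose objects are sets, whose arrows from $X$ to $Y$ are the inner deterministic multirelations $X \leftrightarrow \mathcal{P} Y$, whose composition is Peleg composition $\ast$ and whose identity arrows are the $1_X$. Likewise, the outer deterministic multirelations form a category with Peleg composition and identity arrows $1_X$. Both categories are isomorphic to the category $\mathbf{Rel}$ of sets and binary relations (with relational composition and identity relations).
   Context: A relation $R : X \leftrightarrow Y$ is a subset of $X \times Y$; relational composition is $RS = \{(a,c) \mid \exists b.\ (a,b)\in R \wedge (b,c) \in S\}$. A multirelation $R : X \leftrightarrow \mathcal{P} Y$ is a subset of $X \times \mathcal{P} Y$. $R$ is outer deterministic if it is the graph of a function $X \to \mathcal{P} Y$, i.e. every $a \in X$ is related to exactly one set. $R$ is inner deterministic if $B$ is a singleton set whenever $(a,B) \in R$. $1_X = \{(a,\{a\}) \mid a \in X\}$. The Peleg composition of $R : X \leftrightarrow \mathcal{P} Y$ and $S : Y \leftrightarrow \mathcal{P} Z$ is $R \ast S = \{(a,C) \mid \exists B.\ (a,B) \in R \wedge \exists f : Y \to \mathcal{P} Z.\ (\forall b \in B.\ (b,f(b)) \in S) \wedge C = \bigcup_{b \in B} f(b)\}$. -}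

module Defs where

-- Conventions:
--  * "sets" are Agda types X : Set, element equality is _≡_;
--  * a subset of a set Y (an element of the power set P Y) is a
--    characteristic function Y → Bool, two subsets being equal when they
--    agree pointwise (_≐_); this keeps P Y small (predicative Agda);
--  * a relation X ↔ Y is a family X → Y → Set, a multirelation X ↔ P Y is a
--    family X → (Y → Bool) → Set which is required to respect _≐_ (so that
--    it is really a subset of X × P Y);
--  * two (multi)relations are equal iff they have the same pairs (pointwise ⇔).
--  * the ambient metatheory is classical: the theorem assumes excluded middle.

open import Level using (Level; _⊔_) renaming (suc to lsuc)
open import Data.Bool using (Bool; true; false)
open import Data.Product using (Σ; Σ-syntax; ∃; _×_; _,_)
open import Relation.Binary.PropositionalEquality using (_≡_)
open import Relation.Binary.Structures using (IsEquivalence)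

_⇔_ : ∀ {a b} → Set a → Set b → Set (a ⊔ b)
A ⇔ B = (A → B) × (B → A)

Subset : Set → Set
Subset Y = Y → Bool

_∈_ : {Y : Set} → Y → Subset Y → Set
y ∈ B = B y ≡ true

_≐_ : {Y : Set} → Subset Y → Subset Y → Set
B ≐ C = ∀ y → B y ≡ C y

IsSingletonOf : {Y : Set} → Subset Y → Y → Set
IsSingletonOf {Y} B b = ∀ (y : Y) → (y ∈ B) ⇔ (y ≡ b)

IsUnion : {Y Z : Set} → Subset Z → Subset Y → (Y → Subset Z) → Set
IsUnion {Y} C B f = ∀ z → (z ∈ C) ⇔ (Σ[ b ∈ Y ] (b ∈ B × z ∈ f b))

BRel : Set → Set → Set₁
BRel X Y = X → Y → Set

_⨾_ : {X Y Z : Set} → BRel X Y → BRel Y Z → BRel X Z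
_⨾_ {Y = Y} R S a c = Σ[ b ∈ Y ] (R a b × S b c)

idRel : (X : Set) → BRel X X
idRel X a b = a ≡ b

_≈ᴿ_ : {X Y : Set} → BRel X Y → BRel X Y → Set
_≈ᴿ_ {X} {Y} R S = ∀ (a : X) (b : Y) → R a b ⇔ S a b

MRel : Set → Set → Set₁
MRel X Y = X → Subset Y → Set

-- R is a genuine subset of X × P Y (respects equality of subsets)
Saturated : {X Y : Set} → MRel X Y → Set
Saturated {X} {Y} R = ∀ (a : X) (B C : Subset Y) → B ≐ C → R a B → R a C

InnerDet : {X Y : Set} → MRel X Y → Set
InnerDet {X} {Y} R = ∀ (a : X) (B : Subset Y) → R a B → Σ[ b ∈ Y ] IsSingletonOf B b

OuterDet : {X Y : Set} → MRel X Y → Set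
OuterDet {X} {Y} R =
  ∀ (a : X) → Σ[ B ∈ Subset Y ] (R a B × (∀ (C : Subset Y) → R a C → C ≐ B))

oneM : (X : Set) → MRel X X
oneM X a B = IsSingletonOf B a

_∗_ : {X Y Z : Set} → MRel X Y → MRel Y Z → MRel X Z
_∗_ {X} {Y} {Z} R S a C =
  Σ[ B ∈ Subset Y ] (R a B ×
    Σ[ f ∈ (Y → Subset Z) ] ((∀ (b : Y) → b ∈ B → S b (f b)) × IsUnion C B f))

_≈ᴹ_ : {X Y : Set} → MRel X Y → MRel X Y → Set
_≈ᴹ_ {X} {Y} R S = ∀ (a : X) (B : Subset Y) → R a B ⇔ S a B

DetClass : Set₁
DetClass = ∀ {X Y : Set} → MRel X Y → Set

record Arr (P : DetClass) (X Y : Set) : Set₁ where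
  constructor arr
  field
    rel : MRel X Y
    sat : Saturated rel
    det : P rel
open Arr public

_≈ᴬ_ : {P : DetClass} {X Y : Set} → Arr P X Y → Arr P X Y → Set
f ≈ᴬ g = rel f ≈ᴹ rel g

record IsCategory (Hom : Set → Set → Set₁)
                  (_≈_ : ∀ {X Y} → Hom X Y → Hom X Y → Set)
                  (ident : ∀ {X} → Hom X X)
                  (comp : ∀ {X Y Z} → Hom X Y → Hom Y Z → Hom X Z) : Set₁ where
  field
    ≈-equiv   : ∀ {X Y} → IsEquivalence (_≈_ {X} {Y})
    comp-resp : ∀ {X Y Z} {f f′ : Hom X Y} {g g′ : Hom Y Z} →
                f ≈ f′ → g ≈ g′ → comp f g ≈ comp f′ g′
    assoc     : ∀ {W X Y Z} (f : Hom W X) (g : Hom X Y) (h : Hom Y Z) →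
                comp (comp f g) h ≈ comp f (comp g h)
    identityˡ : ∀ {X Y} (f : Hom X Y) → comp ident f ≈ f
    identityʳ : ∀ {X Y} (f : Hom X Y) → comp f ident ≈ f

record IsoToRel (Hom : Set → Set → Set₁)
                (_≈_ : ∀ {X Y} → Hom X Y → Hom X Y → Set)
                (ident : ∀ {X} → Hom X X)
                (comp : ∀ {X Y Z} → Hom X Y → Hom Y Z → Hom X Z) : Set₁ where
  field
    F      : ∀ {X Y} → BRel X Y → Hom X Y
    G      : ∀ {X Y} → Hom X Y → BRel X Y
    F-resp : ∀ {X Y} {R S : BRel X Y} → R ≈ᴿ S → F R ≈ F S
    G-resp : ∀ {X Y} {f g : Hom X Y} → f ≈ g → G f ≈ᴿ G g
    F-id   : ∀ {X} → F (idRel X) ≈ ident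
    G-id   : ∀ {X} → G (ident {X}) ≈ᴿ idRel X
    F-comp : ∀ {X Y Z} (R : BRel X Y) (S : BRel Y Z) → F (R ⨾ S) ≈ comp (F R) (F S)
    G-comp : ∀ {X Y Z} (f : Hom X Y) (g : Hom Y Z) → G (comp f g) ≈ᴿ (G f ⨾ G g)
    GF     : ∀ {X Y} (R : BRel X Y) → G (F R) ≈ᴿ R
    FG     : ∀ {X Y} (f : Hom X Y) → F (G f) ≈ f

PelegCategoryIsoRel : DetClass → Set₁
PelegCategoryIsoRel P =
  Σ[ comp ∈ (∀ {X Y Z} → Arr P X Y → Arr P Y Z → Arr P X Z) ]
  Σ[ ident ∈ (∀ {X} → Arr P X X) ]
    ((∀ {X Y Z} (f : Arr P X Y) (g : Arr P Y Z) → rel (comp f g) ≡ (rel f ∗ rel g))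
   × (∀ {X} → rel (ident {X}) ≡ oneM X)
   × IsCategory (Arr P) _≈ᴬ_ ident comp
   × IsoToRel (Arr P) _≈ᴬ_ ident comp)

{-# OPTIONS --safe #-}
module Submission where

-- An inner deterministic multirelation is
-- the same as a relation a ~ b, read as (a , {b}); an outer deterministic one
-- is the same as a relation read as (a , {b ∣ a ~ b}).  Under these encodings
-- 1_X is the identity relation and Peleg composition is relational
-- composition: for inner determinism the union ranges over a singleton, for
-- outer determinism the union of the images of the unique image set is the
-- image under the composite.  Identity, associativity and congruence are then
-- inherited from Rel.  Excluded middle is used only to form the sets {b},
-- {b ∣ a ~ b} and unions as Boolean characteristic functions.

open import Defs
open import Axiom.ExcludedMiddle using (ExcludedMiddle)
open import Data.Bool using (Bool; true; false)
open import Data.Product using (_×_; Σ-syntax; _,_; proj₁; proj₂)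
open import Function using (id; _∘_)
open import Level using (0ℓ) renaming (suc to lsuc)
open import Relation.Nullary using (Dec; yes; no; does; contradiction)
open import Relation.Binary.Bundles using (Setoid)
open import Relation.Binary.Structures using (IsEquivalence)
open import Relation.Binary.PropositionalEquality using (_≡_; refl; sym; trans; subst)
import Relation.Binary.Reasoning.Setoid as SetoidReasoning

⇔-refl : {A : Set} → A ⇔ A
⇔-refl = id , id

⇔-sym : {A B : Set} → A ⇔ B → B ⇔ A
⇔-sym (f , g) = g , f

⇔-trans : {A B C : Set} → A ⇔ B → B ⇔ C → A ⇔ C
⇔-trans (f , g) (h , k) = h ∘ f , g ∘ k

≡-from-≡true-⇔ : {x y : Bool} → (x ≡ true) ⇔ (y ≡ true) → x ≡ y
≡-from-≡true-⇔ {true}          (to , _)   = sym (to refl)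
≡-from-≡true-⇔ {false} {true}  (_ , from) = from refl
≡-from-≡true-⇔ {false} {false} _          = refl

≐-sym : {Y : Set} {B C : Subset Y} → B ≐ C → C ≐ B
≐-sym B≐C y = sym (B≐C y)

∈-resp-≐ : {Y : Set} {B C : Subset Y} {y : Y} → B ≐ C → y ∈ B → y ∈ C
∈-resp-≐ {y = y} B≐C y∈B = trans (sym (B≐C y)) y∈B

≐⇒∈-⇔ : {Y : Set} {B C : Subset Y} → B ≐ C → ∀ y → (y ∈ B) ⇔ (y ∈ C)
≐⇒∈-⇔ B≐C y = ∈-resp-≐ B≐C , ∈-resp-≐ (≐-sym B≐C)

∈-⇔⇒≐ : {Y : Set} {B C : Subset Y} → (∀ y → (y ∈ B) ⇔ (y ∈ C)) → B ≐ C
∈-⇔⇒≐ B⇔C y = ≡-from-≡true-⇔ (B⇔C y)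

∈-singleton : {Y : Set} {B : Subset Y} {b : Y} → IsSingletonOf B b → b ∈ B
∈-singleton B≡｛b｝ = proj₂ (B≡｛b｝ _) refl

IsSingletonOf-resp : {Y : Set} {B C : Subset Y} {b : Y} →
  (∀ y → (y ∈ B) ⇔ (y ∈ C)) → IsSingletonOf C b → IsSingletonOf B b
IsSingletonOf-resp B⇔C C≡｛b｝ y = ⇔-trans (B⇔C y) (C≡｛b｝ y)

IsSingletonOf-unique : {Y : Set} {B C : Subset Y} {b : Y} →
  IsSingletonOf B b → IsSingletonOf C b → B ≐ C
IsSingletonOf-unique B≡｛b｝ C≡｛b｝ = ∈-⇔⇒≐ λ y → ⇔-trans (B≡｛b｝ y) (⇔-sym (C≡｛b｝ y))

IsUnion-over-singleton : {Y Z : Set} {C : Subset Z} {B : Subset Y} {f : Y → Subset Z} {b : Y} →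
  IsSingletonOf B b → IsUnion C B f → ∀ z → (z ∈ C) ⇔ (z ∈ f b)
IsUnion-over-singleton {C = C} {f = f} {b} B≡｛b｝ C≡⋃ z = to , from
  where
  to : z ∈ C → z ∈ f b
  to z∈C with proj₁ (C≡⋃ z) z∈C
  ... | b′ , b′∈B , z∈fb′ with proj₁ (B≡｛b｝ b′) b′∈B
  ... | refl = z∈fb′
  from : z ∈ f b → z ∈ C
  from z∈fb = proj₂ (C≡⋃ z) (_ , ∈-singleton B≡｛b｝ , z∈fb)

IsUnion-const : {Y Z : Set} {C : Subset Z} {B : Subset Y} {b : Y} →
  b ∈ B → IsUnion C B (λ _ → C)
IsUnion-const b∈B z = (λ z∈C → _ , b∈B , z∈C) , (λ (_ , _ , z∈C) → z∈C)

IsUnion-unique : {Y Z : Set} {C C′ : Subset Z} {B B′ : Subset Y} {f f′ : Y → Subset Z} →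
  IsUnion C B f → IsUnion C′ B′ f′ → B ≐ B′ → (∀ b → b ∈ B → f b ≐ f′ b) → C ≐ C′
IsUnion-unique C≡⋃ C′≡⋃ B≐B′ f≐f′ = ∈-⇔⇒≐ λ z →
  ⇔-trans (C≡⋃ z) (⇔-trans (same-witnesses z) (⇔-sym (C′≡⋃ z)))
  where
  same-witnesses : ∀ z → _ ⇔ _
  same-witnesses z =
      (λ (b , b∈B , z∈fb) → b , ∈-resp-≐ B≐B′ b∈B , ∈-resp-≐ (f≐f′ b b∈B) z∈fb)
    , (λ (b , b∈B′ , z∈f′b) → let b∈B = ∈-resp-≐ (≐-sym B≐B′) b∈B′ in
                              b , b∈B , ∈-resp-≐ (≐-sym (f≐f′ b b∈B)) z∈f′b)

≈ᴿ-setoid : (X Y : Set) → Setoid (lsuc 0ℓ) 0ℓ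
≈ᴿ-setoid X Y = record
  { Carrier       = BRel X Y
  ; _≈_           = _≈ᴿ_
  ; isEquivalence = record
    { refl  = λ _ _ → ⇔-refl
    ; sym   = λ R≈S a b → ⇔-sym (R≈S a b)
    ; trans = λ R≈S S≈T a b → ⇔-trans (R≈S a b) (S≈T a b)
    }
  }

⨾-cong : {X Y Z : Set} {R R′ : BRel X Y} {S S′ : BRel Y Z} →
  R ≈ᴿ R′ → S ≈ᴿ S′ → (R ⨾ S) ≈ᴿ (R′ ⨾ S′)
⨾-cong R≈R′ S≈S′ a c =
    (λ (b , r , s) → b , proj₁ (R≈R′ a b) r , proj₁ (S≈S′ b c) s)
  , (λ (b , r , s) → b , proj₂ (R≈R′ a b) r , proj₂ (S≈S′ b c) s)

⨾-assoc : {W X Y Z : Set} (R : BRel W X) (S : BRel X Y) (T : BRel Y Z) →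
  ((R ⨾ S) ⨾ T) ≈ᴿ (R ⨾ (S ⨾ T))
⨾-assoc R S T a d = (λ (c , (b , r , s) , t) → b , r , c , s , t)
                  , (λ (b , r , c , s , t) → c , (b , r , s) , t)

⨾-identityˡ : {X Y : Set} (R : BRel X Y) → (idRel X ⨾ R) ≈ᴿ R
⨾-identityˡ R a b = (λ { (_ , refl , r) → r }) , (λ r → a , refl , r)

⨾-identityʳ : {X Y : Set} (R : BRel X Y) → (R ⨾ idRel Y) ≈ᴿ R
⨾-identityʳ R a b = (λ { (_ , r , refl) → r }) , (λ r → b , r , refl)

-- Hom-sets in bijection with those of Rel, via a functor G, form a category
-- isomorphic to Rel: every law is reflected from Rel along G.
record RelCopy (Hom : Set → Set → Set₁)
               (_≈_ : ∀ {X Y} → Hom X Y → Hom X Y → Set)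
               (ident : ∀ {X} → Hom X X)
               (comp : ∀ {X Y Z} → Hom X Y → Hom Y Z → Hom X Z) : Set₁ where
  field
    ≈-equiv : ∀ {X Y} → IsEquivalence (_≈_ {X} {Y})
    F       : ∀ {X Y} → BRel X Y → Hom X Y
    G       : ∀ {X Y} → Hom X Y → BRel X Y
    F-resp  : ∀ {X Y} {R S : BRel X Y} → R ≈ᴿ S → F R ≈ F S
    G-resp  : ∀ {X Y} {f g : Hom X Y} → f ≈ g → G f ≈ᴿ G g
    G-id    : ∀ {X} → G (ident {X}) ≈ᴿ idRel X
    G-comp  : ∀ {X Y Z} (f : Hom X Y) (g : Hom Y Z) → G (comp f g) ≈ᴿ (G f ⨾ G g)
    GF      : ∀ {X Y} (R : BRel X Y) → G (F R) ≈ᴿ R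
    FG      : ∀ {X Y} (f : Hom X Y) → F (G f) ≈ f

  private
    module ≈ {X} {Y} = IsEquivalence (≈-equiv {X} {Y})
    module ≈ᴿ {X} {Y} = Setoid (≈ᴿ-setoid X Y)
    open module R-Reasoning {X} {Y} = SetoidReasoning (≈ᴿ-setoid X Y)

  G-reflects : ∀ {X Y} {f g : Hom X Y} → G f ≈ᴿ G g → f ≈ g
  G-reflects {f = f} {g} Gf≈Gg = ≈.trans (≈.sym (FG f)) (≈.trans (F-resp Gf≈Gg) (FG g))

  isCategory : IsCategory Hom _≈_ ident comp
  isCategory = record
    { ≈-equiv   = ≈-equiv
    ; comp-resp = λ {_} {_} {_} {f} {f′} {g} {g′} f≈f′ g≈g′ → G-reflects (begin
        G (comp f g)    ≈⟨ G-comp f g ⟩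
        G f ⨾ G g       ≈⟨ ⨾-cong (G-resp f≈f′) (G-resp g≈g′) ⟩
        G f′ ⨾ G g′     ≈⟨ G-comp f′ g′ ⟨
        G (comp f′ g′)  ∎)
    ; assoc     = λ f g h → G-reflects (begin
        G (comp (comp f g) h)  ≈⟨ G-comp (comp f g) h ⟩
        G (comp f g) ⨾ G h     ≈⟨ ⨾-cong (G-comp f g) ≈ᴿ.refl ⟩
        (G f ⨾ G g) ⨾ G h      ≈⟨ ⨾-assoc (G f) (G g) (G h) ⟩
        G f ⨾ (G g ⨾ G h)      ≈⟨ ⨾-cong ≈ᴿ.refl (G-comp g h) ⟨
        G f ⨾ G (comp g h)     ≈⟨ G-comp f (comp g h) ⟨
        G (comp f (comp g h))  ∎)
    ; identityˡ = λ f → G-reflects (begin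
        G (comp ident f)  ≈⟨ G-comp ident f ⟩
        G ident ⨾ G f     ≈⟨ ⨾-cong G-id ≈ᴿ.refl ⟩
        idRel _ ⨾ G f     ≈⟨ ⨾-identityˡ (G f) ⟩
        G f               ∎)
    ; identityʳ = λ f → G-reflects (begin
        G (comp f ident)  ≈⟨ G-comp f ident ⟩
        G f ⨾ G ident     ≈⟨ ⨾-cong ≈ᴿ.refl G-id ⟩
        G f ⨾ idRel _     ≈⟨ ⨾-identityʳ (G f) ⟩
        G f               ∎)
    }

  isoToRel : IsoToRel Hom _≈_ ident comp
  isoToRel = record
    { F      = F
    ; G      = G
    ; F-resp = F-resp
    ; G-resp = G-resp
    ; F-id   = G-reflects (≈ᴿ.trans (GF _) (≈ᴿ.sym G-id))
    ; G-id   = G-id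
    ; F-comp = λ R S → G-reflects (begin
        G (F (R ⨾ S))        ≈⟨ GF (R ⨾ S) ⟩
        R ⨾ S                ≈⟨ ⨾-cong (GF R) (GF S) ⟨
        G (F R) ⨾ G (F S)    ≈⟨ G-comp (F R) (F S) ⟨
        G (comp (F R) (F S)) ∎)
    ; G-comp = G-comp
    ; GF     = GF
    ; FG     = FG
    }

≈ᴬ-isEquivalence : {P : DetClass} {X Y : Set} → IsEquivalence (_≈ᴬ_ {P} {X} {Y})
≈ᴬ-isEquivalence = record
  { refl  = λ _ _ → ⇔-refl
  ; sym   = λ f≈g a B → ⇔-sym (f≈g a B)
  ; trans = λ f≈g g≈h a B → ⇔-trans (f≈g a B) (g≈h a B)
  }

∗-saturated : {X Y Z : Set} (R : MRel X Y) (S : MRel Y Z) → Saturated (R ∗ S)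
∗-saturated R S a C C′ C≐C′ (B , r , f , fS , C≡⋃) =
  B , r , f , fS , λ z → ⇔-trans (≐⇒∈-⇔ (≐-sym C≐C′) z) (C≡⋃ z)

oneM-saturated : {X : Set} → Saturated (oneM X)
oneM-saturated a B C B≐C B≡｛a｝ = IsSingletonOf-resp (≐⇒∈-⇔ (≐-sym B≐C)) B≡｛a｝

module PelegArrows (P : DetClass)
  (∗-closed : ∀ {X Y Z} {R : MRel X Y} {S : MRel Y Z} → P R → P S → P (R ∗ S))
  (oneM-closed : ∀ {X} → P (oneM X)) where

  _⊙_ : ∀ {X Y Z} → Arr P X Y → Arr P Y Z → Arr P X Z
  f ⊙ g = arr (rel f ∗ rel g) (∗-saturated (rel f) (rel g)) (∗-closed (det f) (det g))

  1ᴬ : ∀ {X} → Arr P X X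
  1ᴬ = arr (oneM _) oneM-saturated oneM-closed

  pelegCategoryIsoRel : RelCopy (Arr P) _≈ᴬ_ 1ᴬ _⊙_ → PelegCategoryIsoRel P
  pelegCategoryIsoRel copy = _⊙_ , 1ᴬ , (λ f g → refl) , refl , isCategory , isoToRel
    where open RelCopy copy

module Comprehension (em : ExcludedMiddle 0ℓ) where

  ⟦_⟧ : {Y : Set} → (Y → Set) → Subset Y
  ⟦ Q ⟧ y = does (em {Q y})

  ∈-⟦⟧ : {Y : Set} (Q : Y → Set) {y : Y} → (y ∈ ⟦ Q ⟧) ⇔ Q y
  ∈-⟦⟧ Q {y} with em {Q y}
  ... | yes q = (λ _ → q) , (λ _ → refl)
  ... | no ¬q = (λ ()) , (λ q → contradiction q ¬q)

  singleton : {Y : Set} → Y → Subset Y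
  singleton b = ⟦ _≡ b ⟧

  singleton-IsSingletonOf : {Y : Set} (b : Y) → IsSingletonOf (singleton b) b
  singleton-IsSingletonOf b y = ∈-⟦⟧ (_≡ b)

  ⋃ : {Y Z : Set} → Subset Y → (Y → Subset Z) → Subset Z
  ⋃ {Y} B f = ⟦ (λ z → Σ[ b ∈ Y ] (b ∈ B × z ∈ f b)) ⟧

  ⋃-IsUnion : {Y Z : Set} (B : Subset Y) (f : Y → Subset Z) → IsUnion (⋃ B f) B f
  ⋃-IsUnion {Y} B f z = ∈-⟦⟧ (λ z → Σ[ b ∈ Y ] (b ∈ B × z ∈ f b))

∗-innerDet : {X Y Z : Set} {R : MRel X Y} {S : MRel Y Z} →
  InnerDet R → InnerDet S → InnerDet (R ∗ S)
∗-innerDet R-det S-det a C (B , r , f , fS , C≡⋃) =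
  let b , B≡｛b｝   = R-det a B r
      c , fb≡｛c｝ = S-det b (f b) (fS b (∈-singleton B≡｛b｝))
  in  c , IsSingletonOf-resp (IsUnion-over-singleton B≡｛b｝ C≡⋃) fb≡｛c｝

oneM-innerDet : {X : Set} → InnerDet (oneM X)
oneM-innerDet a B B≡｛a｝ = a , B≡｛a｝

module InnerDeterministic (em : ExcludedMiddle 0ℓ) where
  open Comprehension em
  open PelegArrows InnerDet (λ {X Y Z R S} → ∗-innerDet {X} {Y} {Z} {R} {S}) oneM-innerDet

  toArr : {X Y : Set} → BRel X Y → Arr InnerDet X Y
  toArr R = arr (λ a B → Σ[ b ∈ _ ] (R a b × IsSingletonOf B b))
                (λ a B C B≐C (b , r , B≡｛b｝) →
                   b , r , IsSingletonOf-resp (≐⇒∈-⇔ (≐-sym B≐C)) B≡｛b｝)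
                (λ a B (b , _ , B≡｛b｝) → b , B≡｛b｝)

  toRel : {X Y : Set} → Arr InnerDet X Y → BRel X Y
  toRel f a b = Σ[ B ∈ Subset _ ] (rel f a B × IsSingletonOf B b)

  toRel-⊙ : {X Y Z : Set} (f : Arr InnerDet X Y) (g : Arr InnerDet Y Z) →
    toRel (f ⊙ g) ≈ᴿ (toRel f ⨾ toRel g)
  toRel-⊙ f g a c = to , from
    where
    to : toRel (f ⊙ g) a c → (toRel f ⨾ toRel g) a c
    to (C , (B , r , h , hS , C≡⋃) , C≡｛c｝) =
      let b , B≡｛b｝ = det f a B r
          hb≡C      = IsUnion-over-singleton B≡｛b｝ C≡⋃
      in  b , (B , r , B≡｛b｝) , (h b , hS b (∈-singleton B≡｛b｝) ,
                                  IsSingletonOf-resp (⇔-sym ∘ hb≡C) C≡｛c｝)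
    from : (toRel f ⨾ toRel g) a c → toRel (f ⊙ g) a c
    from (b , (B , r , B≡｛b｝) , (C , s , C≡｛c｝)) =
      C , (B , r , (λ _ → C) , gC , IsUnion-const (∈-singleton B≡｛b｝)) , C≡｛c｝
      where
      gC : ∀ b′ → b′ ∈ B → rel g b′ C
      gC b′ b′∈B = subst (λ b″ → rel g b″ C) (sym (proj₁ (B≡｛b｝ b′) b′∈B)) s

  relCopy : RelCopy (Arr InnerDet) _≈ᴬ_ 1ᴬ _⊙_
  relCopy = record
    { ≈-equiv = ≈ᴬ-isEquivalence
    ; F       = toArr
    ; G       = toRel
    ; F-resp  = λ R≈S a B → (λ (b , r , s) → b , proj₁ (R≈S a b) r , s)
                          , (λ (b , r , s) → b , proj₂ (R≈S a b) r , s)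
    ; G-resp  = λ f≈g a b → (λ (B , r , s) → B , proj₁ (f≈g a B) r , s)
                          , (λ (B , r , s) → B , proj₂ (f≈g a B) r , s)
    ; G-id    = λ a b → (λ (B , B≡｛a｝ , B≡｛b｝) → proj₁ (B≡｛b｝ a) (∈-singleton B≡｛a｝))
                      , (λ { refl → singleton a , singleton-IsSingletonOf a
                                                , singleton-IsSingletonOf a })
    ; G-comp  = toRel-⊙
    ; GF      = λ R a b →
        (λ (B , (b′ , r , B≡｛b′｝) , B≡｛b｝) →
           subst (R a) (proj₁ (B≡｛b｝ b′) (∈-singleton B≡｛b′｝)) r)
      , (λ r → singleton b , (b , r , singleton-IsSingletonOf b) , singleton-IsSingletonOf b)
    ; FG      = λ f a B →
        (λ (b , (B′ , r , B′≡｛b｝) , B≡｛b｝) →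
           sat f a B′ B (IsSingletonOf-unique B′≡｛b｝ B≡｛b｝) r)
      , (λ r → let b , B≡｛b｝ = det f a B r in b , (B , r , B≡｛b｝) , B≡｛b｝)
    }

  innerDet-pelegCategoryIsoRel : PelegCategoryIsoRel InnerDet
  innerDet-pelegCategoryIsoRel = pelegCategoryIsoRel relCopy

module _ {X Y : Set} {R : MRel X Y} (R-det : OuterDet R) where

  image : X → Subset Y
  image a = proj₁ (R-det a)

  image-related : ∀ a → R a (image a)
  image-related a = proj₁ (proj₂ (R-det a))

  image-unique : ∀ a B → R a B → B ≐ image a
  image-unique a = proj₂ (proj₂ (R-det a))

module OuterDeterministic (em : ExcludedMiddle 0ℓ) where
  open Comprehension em

  ∗-related-⋃-image : {X Y Z : Set} {R : MRel X Y} {S : MRel Y Z} {a : X} {B : Subset Y} →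
    (S-det : OuterDet S) → R a B → (R ∗ S) a (⋃ B (image S-det))
  ∗-related-⋃-image {B = B} S-det r =
    B , r , image S-det , (λ b _ → image-related S-det b) , ⋃-IsUnion B (image S-det)

  ∗-outerDet : {X Y Z : Set} {R : MRel X Y} {S : MRel Y Z} →
    OuterDet R → OuterDet S → OuterDet (R ∗ S)
  ∗-outerDet {R = R} R-det S-det a =
      ⋃ (image R-det a) (image S-det)
    , ∗-related-⋃-image {R = R} S-det (image-related R-det a)
    , λ C (B , r , f , fS , C≡⋃) →
        IsUnion-unique C≡⋃ (⋃-IsUnion _ _) (image-unique R-det a B r)
                       (λ b b∈B → image-unique S-det b (f b) (fS b b∈B))

  oneM-outerDet : {X : Set} → OuterDet (oneM X)
  oneM-outerDet a = singleton a , singleton-IsSingletonOf a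
                  , λ C C≡｛a｝ → IsSingletonOf-unique C≡｛a｝ (singleton-IsSingletonOf a)

  open PelegArrows OuterDet (λ {X Y Z R S} → ∗-outerDet {X} {Y} {Z} {R} {S}) oneM-outerDet

  toArr : {X Y : Set} → BRel X Y → Arr OuterDet X Y
  toArr R = arr (λ a B → ∀ y → (y ∈ B) ⇔ R a y)
                (λ a B C B≐C B≡R[a] y → ⇔-trans (≐⇒∈-⇔ (≐-sym B≐C) y) (B≡R[a] y))
                (λ a → ⟦ R a ⟧ , (λ y → ∈-⟦⟧ (R a))
                     , λ C C≡R[a] → ∈-⇔⇒≐ λ y → ⇔-trans (C≡R[a] y) (⇔-sym (∈-⟦⟧ (R a))))

  toRel : {X Y : Set} → Arr OuterDet X Y → BRel X Y
  toRel f a b = Σ[ B ∈ Subset _ ] (rel f a B × b ∈ B)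

  toRel-⇔-∈-image : {X Y : Set} (f : Arr OuterDet X Y) {a : X} {y : Y} →
    toRel f a y ⇔ (y ∈ image (det f) a)
  toRel-⇔-∈-image f {a} = (λ (B , r , y∈B) → ∈-resp-≐ (image-unique (det f) a B r) y∈B)
                        , (λ y∈image → image (det f) a , image-related (det f) a , y∈image)

  toRel-⊙ : {X Y Z : Set} (f : Arr OuterDet X Y) (g : Arr OuterDet Y Z) →
    toRel (f ⊙ g) ≈ᴿ (toRel f ⨾ toRel g)
  toRel-⊙ f g a c =
      (λ (C , (B , r , h , hS , C≡⋃) , c∈C) →
         let b , b∈B , c∈hb = proj₁ (C≡⋃ c) c∈C
         in  b , (B , r , b∈B) , (h b , hS b b∈B , c∈hb))
    , (λ (b , (B , r , b∈B) , (C , s , c∈C)) →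
           ⋃ B (image (det g)) , ∗-related-⋃-image {R = rel f} (det g) r
         , proj₂ (⋃-IsUnion B (image (det g)) c)
                 (b , b∈B , ∈-resp-≐ (image-unique (det g) b C s) c∈C))

  relCopy : RelCopy (Arr OuterDet) _≈ᴬ_ 1ᴬ _⊙_
  relCopy = record
    { ≈-equiv = ≈ᴬ-isEquivalence
    ; F       = toArr
    ; G       = toRel
    ; F-resp  = λ R≈S a B → (λ B≡R[a] y → ⇔-trans (B≡R[a] y) (R≈S a y))
                          , (λ B≡S[a] y → ⇔-trans (B≡S[a] y) (⇔-sym (R≈S a y)))
    ; G-resp  = λ f≈g a b → (λ (B , r , b∈B) → B , proj₁ (f≈g a B) r , b∈B)
                          , (λ (B , r , b∈B) → B , proj₂ (f≈g a B) r , b∈B)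
    ; G-id    = λ a b → (λ (B , B≡｛a｝ , b∈B) → sym (proj₁ (B≡｛a｝ b) b∈B))
                      , (λ { refl → singleton a , singleton-IsSingletonOf a
                                                , ∈-singleton (singleton-IsSingletonOf a) })
    ; G-comp  = toRel-⊙
    ; GF      = λ R a b → (λ (B , B≡R[a] , b∈B) → proj₁ (B≡R[a] b) b∈B)
                        , (λ r → ⟦ R a ⟧ , (λ y → ∈-⟦⟧ (R a)) , proj₂ (∈-⟦⟧ (R a)) r)
    ; FG      = λ f a B →
        (λ B≡image → sat f a (image (det f) a) B
                       (∈-⇔⇒≐ λ y → ⇔-sym (⇔-trans (B≡image y) (toRel-⇔-∈-image f)))
                       (image-related (det f) a))
      , (λ r y → ⇔-trans (≐⇒∈-⇔ (image-unique (det f) a B r) y) (⇔-sym (toRel-⇔-∈-image f)))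
    }

  outerDet-pelegCategoryIsoRel : PelegCategoryIsoRel OuterDet
  outerDet-pelegCategoryIsoRel = pelegCategoryIsoRel relCopy

proposition3p5 : (∀ (A : Set) → Dec A) →
    PelegCategoryIsoRel InnerDet × PelegCategoryIsoRel OuterDet
proposition3p5 em = InnerDeterministic.innerDet-pelegCategoryIsoRel (λ {A} → em A)
                  , OuterDeterministic.outerDet-pelegCategoryIsoRel (λ {A} → em A)
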